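{- For every positive integer $n$, $|B_n(132,213,321)|=|B_n(132,312,321)|=|B_n(213,231,321)|$.
   Context: A permutation $\sigma\in S_n$ is written as $\sigma(1)\cdots\sigma(n)$. An index $i\in[n-1]$ is an ascent if $\sigma(i)<\sigma(i+1)$ and a descent if $\sigma(i)>\sigma(i+1)$. A ballot permutation is a permutation such that every prefix $\sigma(1)\cdots\sigma(p)$ has at least as many ascents as descents. $\sigma$ contains a pattern $\pi\in S_k$ if some subsequence $\sigma(c_1)\cdots\sigma(c_k)$ with $c_1<\dots<c_k$ is order-isomorphic to $\pi$, and avoids $\pi$ otherwise. $B_n(\pi_1,\dots,\pi_m)$ denotes the set of ballot permutations of length $n$ avoiding all of $\pi_1,\dots,\pi_m$. -}

module Defs where

open import Data.Nat using (ℕ; zero; suc; _<_; _≤_; _<ᵇ_; _+_)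
open import Data.Bool using (if_then_else_)
open import Relation.Binary.PropositionalEquality using (_≡_)
open import Data.List using (List; []; _∷_; length; map; upTo; lookup)
open import Data.List.Relation.Binary.Permutation.Propositional using (_↭_)
open import Data.List.Relation.Unary.Unique.Propositional using (Unique)
open import Data.List.Membership.Propositional using (_∈_)
open import Data.Fin using (Fin; toℕ; fromℕ<) renaming (_<_ to _<ᶠ_)
open import Data.Product using (Σ; ∃; _×_; _,_)
open import Function using (_⇔_)
open import Relation.Nullary using (¬_; yes; no)

IsPerm : ℕ → List ℕ → Set
IsPerm n σ = σ ↭ map suc (upTo n)

ascFrom : ℕ → List ℕ → ℕ
ascFrom x [] = 0
ascFrom x (y ∷ xs) = (if x <ᵇ y then 1 else 0) + ascFrom y xs

desFrom : ℕ → List ℕ → ℕ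
desFrom x [] = 0
desFrom x (y ∷ xs) = (if y <ᵇ x then 1 else 0) + desFrom y xs

asc : List ℕ → ℕ
asc [] = 0
asc (x ∷ xs) = ascFrom x xs

des : List ℕ → ℕ
des [] = 0
des (x ∷ xs) = desFrom x xs

data Prefix : List ℕ → List ℕ → Set where
  pre-[] : ∀ {ys} → Prefix [] ys
  pre-∷  : ∀ {x xs ys} → Prefix xs ys → Prefix (x ∷ xs) (x ∷ ys)

IsBallot : List ℕ → Set
IsBallot σ = ∀ p → Prefix p σ → des p ≤ asc p

Contains : List ℕ → List ℕ → Set
Contains σ π =
  Σ (Fin (length π) → Fin (length σ)) λ c →
    (∀ a b → a <ᶠ b → c a <ᶠ c b) ×
    (∀ a b → (lookup σ (c a) < lookup σ (c b) → lookup π a < lookup π b)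
           × (lookup π a < lookup π b → lookup σ (c a) < lookup σ (c b)))

Avoids : List ℕ → List ℕ → Set
Avoids σ π = ¬ Contains σ π

InB3 : ℕ → List ℕ → List ℕ → List ℕ → List ℕ → Set
InB3 n π₁ π₂ π₃ σ = IsPerm n σ × IsBallot σ × Avoids σ π₁ × Avoids σ π₂ × Avoids σ π₃

HasCard : (List ℕ → Set) → ℕ → Set
HasCard S k = Σ (List (List ℕ)) λ L → Unique L × (∀ σ → (σ ∈ L) ⇔ S σ) × length L ≡ k

-- Avoiding 132, 213 and 321 forces a permutation to be a rotation (k+1 … n)(1 … k) of the identity;
-- avoiding 132, 312 and 321 forces it to be the identity with the entry 1 moved, and avoiding 213, 231
-- and 321 the identity with the entry n moved.  Conversely every triple of entries of such a permutation
-- has one of three order types, none of them forbidden.  Each of these permutations is a concatenation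
-- of two increasing runs, so it has at most one descent and is a ballot permutation exactly when it
-- does not begin with a descent.  For n ≥ 2 this discards exactly one of the n candidates in each
-- family, leaving n − 1 ballot permutations in all three sets (and one when n = 1).

module Submission where

open import Defs
open import Data.Nat
  using (ℕ; zero; suc; _+_; _∸_; _≤_; _<_; _>_; _<ᵇ_; _<?_; z≤n; s≤s; z<s; s<s; s<s⁻¹; s≤s⁻¹)
open import Data.Nat.Properties
open import Data.Bool using (true; false; if_then_else_)
open import Data.Bool.Properties using (T-≡; ¬-not)
open import Data.Fin using (Fin; zero; suc) renaming (_<_ to _<ᶠ_)
import Data.Fin.Properties as Fin
open import Data.List using (List; []; _∷_; _++_; length; lookup; map; upTo; applyUpTo)
open import Data.List.Properties
  using (++-identityʳ; ++-assoc; length-++; length-map; map-upTo; ∷-injective; ∷-injectiveˡ; ∷ʳ-injective)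
open import Data.List.Membership.Propositional using (_∈_; _∉_)
open import Data.List.Membership.Propositional.Properties
  using (∈-lookup; ∈-++⁺ʳ; ∈-++⁻; ∈-map⁺; ∈-map⁻)
open import Data.List.Relation.Unary.Any as Any using (Any; here; there; any?)
open import Data.List.Relation.Unary.All as All using (All; []; _∷_)
import Data.List.Relation.Unary.All.Properties as All
open import Data.List.Relation.Unary.AllPairs using (AllPairs; []; _∷_)
import Data.List.Relation.Unary.AllPairs as AllPairs
open import Data.List.Relation.Unary.Unique.Propositional using (Unique)
open import Data.List.Relation.Unary.Linked.Properties using (AllPairs⇒Linked)
import Data.List.Relation.Unary.Linked as Linked
open import Data.List.Relation.Unary.Sorted.TotalOrder.Properties using (↗↭↗⇒≋)
open import Data.List.Relation.Binary.Pointwise using (Pointwise-≡⇒≡)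
open import Data.List.Relation.Binary.Sublist.Propositional
  using (_⊆_; []; _∷_; _∷ʳ_; minimum; from∈; ⊆-refl)
import Data.List.Relation.Binary.Sublist.Propositional.Properties as Sublist
open import Data.List.Relation.Binary.Permutation.Propositional
  using (_↭_; ↭-sym; ↭-trans; ↭-reflexive; ↭⇒↭ₛ)
open import Data.List.Relation.Binary.Permutation.Propositional.Properties
  using (++-comm; shift; ∷↭∷ʳ; ↭-length)
open import Data.List.Relation.Binary.Permutation.Setoid.Properties using (Unique-resp-↭)
open import Data.Product using (Σ; ∃-syntax; _×_; _,_; proj₁; proj₂)
open import Data.Sum using (_⊎_; inj₁; inj₂)
open import Data.Empty using (⊥-elim)
open import Function using (_∘_; mk⇔; Equivalence)
open import Relation.Binary using (tri<; tri≈; tri>)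
open import Relation.Binary.PropositionalEquality
open import Relation.Nullary using (Dec; ¬_)
open import Relation.Nullary.Decidable using (False; toWitnessFalse; _×-dec_; _→-dec_)

private
  variable
    x y z a m k n : ℕ
    t u v w σ τ : List ℕ

-- Increasing lists and ranges

Increasing : List ℕ → Set
Increasing = AllPairs _<_

increasing₃ : x < y → y < z → Increasing (x ∷ y ∷ z ∷ [])
increasing₃ x<y y<z = (x<y ∷ <-trans x<y y<z ∷ []) ∷ (y<z ∷ []) ∷ [] ∷ []

AllPairs-resp-⊆ : ∀ {A : Set} {R : A → A → Set} {t σ : List A} →
  t ⊆ σ → AllPairs R σ → AllPairs R t
AllPairs-resp-⊆ [] [] = []
AllPairs-resp-⊆ (_ ∷ʳ t⊆σ) (_ ∷ σ↗) = AllPairs-resp-⊆ t⊆σ σ↗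
AllPairs-resp-⊆ (refl ∷ t⊆σ) (Rx ∷ σ↗) =
  Sublist.All-resp-⊆ t⊆σ Rx ∷ AllPairs-resp-⊆ t⊆σ σ↗

increasing-insert : Increasing (v ++ u) → All (_< x) v → All (x <_) u → Increasing (v ++ x ∷ u)
increasing-insert {[]} u↗ [] x<u = x<u ∷ u↗
increasing-insert {b ∷ v} (b<vu ∷ vu↗) (b<x ∷ v<x) x<u =
  All.++⁺ (All.++⁻ˡ v b<vu) (b<x ∷ All.++⁻ʳ v b<vu) ∷ increasing-insert vu↗ v<x x<u

increasing-++⁻ : Increasing (v ++ u) → y ∈ v → z ∈ u → y < z
increasing-++⁻ {_ ∷ v} (y<vu ∷ _) (here refl) z∈u = All.lookup y<vu (∈-++⁺ʳ v z∈u)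
increasing-++⁻ {_ ∷ v} (_ ∷ vu↗) (there y∈v) z∈u = increasing-++⁻ vu↗ y∈v z∈u

increasing-↭ : Increasing u → Increasing v → u ↭ v → u ≡ v
increasing-↭ u↗ v↗ u↭v =
  Pointwise-≡⇒≡ (↗↭↗⇒≋ ≤-totalOrder (sorted u↗) (sorted v↗) (↭⇒↭ₛ u↭v))
  where
  sorted : Increasing t → Linked.Linked _≤_ t
  sorted t↗ = Linked.map <⇒≤ (AllPairs⇒Linked t↗)

all-below : All (x ≢_) t → (∀ {z} → z ∈ t → ¬ x < z) → All (_< x) t
all-below x∉t x≮t =
  All.tabulate λ z∈t → ≤∧≢⇒< (≮⇒≥ (x≮t z∈t)) (All.lookup x∉t z∈t ∘ sym)

all-above : All (x ≢_) t → (∀ {z} → z ∈ t → ¬ z < x) → All (x <_) t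
all-above x∉t t≮x =
  All.tabulate λ z∈t → ≤∧≢⇒< (≮⇒≥ (t≮x z∈t)) (All.lookup x∉t z∈t)

range : ℕ → ℕ → List ℕ
range a zero = []
range a (suc n) = a ∷ range (suc a) n

length-range : ∀ a n → length (range a n) ≡ n
length-range a zero = refl
length-range a (suc n) = cong suc (length-range (suc a) n)

∈-range⁻ : x ∈ range a n → a ≤ x × x < a + n
∈-range⁻ {a = a} {suc n} (here refl) = ≤-refl , m<m+n a z<s
∈-range⁻ {x} {a} {suc n} (there x∈r) with ∈-range⁻ x∈r
... | a<x , x<1+a+n = <⇒≤ a<x , subst (x <_) (sym (+-suc a n)) x<1+a+n

∈-range⁺ : a ≤ x → x < a + n → x ∈ range a n
∈-range⁺ {a} {x} {zero} a≤x x<a+0 = ⊥-elim (<⇒≱ (subst (x <_) (+-identityʳ a) x<a+0) a≤x)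
∈-range⁺ {a} {x} {suc n} a≤x x<a+1+n with m≤n⇒m<n∨m≡n a≤x
... | inj₂ refl = here refl
... | inj₁ a<x = there (∈-range⁺ a<x (subst (x <_) (+-suc a n) x<a+1+n))

range-increasing : ∀ a n → Increasing (range a n)
range-increasing a zero = []
range-increasing a (suc n) = All.tabulate (proj₁ ∘ ∈-range⁻) ∷ range-increasing (suc a) n

range-++ : ∀ a m n → range a m ++ range (a + m) n ≡ range a (m + n)
range-++ a zero n = cong (λ b → range b n) (+-identityʳ a)
range-++ a (suc m) n = cong (a ∷_) (begin
  range (suc a) m ++ range (a + suc m) n  ≡⟨ cong (λ b → range (suc a) m ++ range b n) (+-suc a m) ⟩
  range (suc a) m ++ range (suc a + m) n  ≡⟨ range-++ (suc a) m n ⟩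
  range (suc a) (m + n)                   ∎)
  where open ≡-Reasoning

range-split : m ≤ n → range a m ++ range (a + m) (n ∸ m) ≡ range a n
range-split {m} {n} {a} m≤n = trans (range-++ a m (n ∸ m)) (cong (range a) (m+[n∸m]≡n m≤n))

range-∷ʳ : ∀ a n → range a (suc n) ≡ range a n ++ a + n ∷ []
range-∷ʳ a n = trans (cong (range a) (+-comm 1 n)) (sym (range-++ a n 1))

++-range⁻ : ∀ u → u ++ v ≡ range a n →
  u ≡ range a (length u) × v ≡ range (a + length u) (n ∸ length u)
++-range⁻ {a = a} [] v≡r = refl , trans v≡r (cong (λ b → range b _) (sym (+-identityʳ a)))
++-range⁻ {n = zero} (_ ∷ _) ()
++-range⁻ {v} {a} {suc n} (x ∷ u) eq with ∷-injective eq
... | refl , u++v≡r with ++-range⁻ u u++v≡r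
...   | u≡r , v≡r =
  cong (a ∷_) u≡r , trans v≡r (cong (λ b → range b (n ∸ length u)) (sym (+-suc a (length u))))

length-++-range : ∀ u → u ++ v ≡ range a n → length u + length v ≡ n
length-++-range {v} {a} {n} u eq = trans (sym (length-++ u)) (trans (cong length eq) (length-range a n))

range-unique : ∀ a n → Unique (range a n)
range-unique a n = AllPairs.map <⇒≢ (range-increasing a n)

∈-range∸1⁻ : k ∈ range a (n ∸ 1) → a ≤ k × suc k < a + n
∈-range∸1⁻ {k} {a} {suc n} k∈r with ∈-range⁻ k∈r
... | a≤k , k<a+n = a≤k , subst (suc k <_) (sym (+-suc a n)) (s<s k<a+n)

∈-range∸1⁺ : a ≤ k → suc k < a + n → k ∈ range a (n ∸ 1)
∈-range∸1⁺ {a} {k} {zero} a≤k k<a+0 =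
  ⊥-elim (<⇒≱ (<-trans (n<1+n k) (subst (suc k <_) (+-identityʳ a) k<a+0)) a≤k)
∈-range∸1⁺ {a} {k} {suc n} a≤k k<a+1+n = ∈-range⁺ a≤k (s<s⁻¹ (subst (suc k <_) (+-suc a n) k<a+1+n))

m+o≡n∧p≤o⇒p+m≤n : ∀ {m o p} → m + o ≡ n → p ≤ o → p + m ≤ n
m+o≡n∧p≤o⇒p+m≤n {n} {m} {o} {p} m+o≡n p≤o =
  subst (_≤ n) (+-comm m p) (subst (m + p ≤_) m+o≡n (+-monoʳ-≤ m p≤o))

++-∷-cancel : ∀ {A : Set} {x : A} {u u′ w w′} → x ∉ u → x ∉ u′ →
  u ++ x ∷ w ≡ u′ ++ x ∷ w′ → u ≡ u′
++-∷-cancel {u = []} {[]} _ _ _ = refl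
++-∷-cancel {u = []} {_ ∷ _} _ x∉u′ eq = ⊥-elim (x∉u′ (here (∷-injectiveˡ eq)))
++-∷-cancel {u = _ ∷ _} {[]} x∉u _ eq = ⊥-elim (x∉u (here (sym (∷-injectiveˡ eq))))
++-∷-cancel {u = a ∷ u} {a′ ∷ u′} x∉au x∉au′ eq with ∷-injective eq
... | refl , eq′ = cong (a ∷_) (++-∷-cancel (x∉au ∘ there) (x∉au′ ∘ there) eq′)

upTo-range : ∀ n → map suc (upTo n) ≡ range 1 n
upTo-range n = trans (map-upTo suc n) (applyUpTo-range suc 1 n λ _ → refl)
  where
  applyUpTo-range : ∀ (f : ℕ → ℕ) a n → (∀ i → f i ≡ a + i) → applyUpTo f n ≡ range a n
  applyUpTo-range f a zero _ = refl
  applyUpTo-range f a (suc n) f≡ =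
    cong₂ _∷_ (trans (f≡ 0) (+-identityʳ a))
              (applyUpTo-range (f ∘ suc) (suc a) n λ i → trans (f≡ (suc i)) (+-suc a i))

-- Patterns of length three

p132 p213 p231 p312 p321 : List ℕ
p132 = 1 ∷ 3 ∷ 2 ∷ []
p213 = 2 ∷ 1 ∷ 3 ∷ []
p231 = 2 ∷ 3 ∷ 1 ∷ []
p312 = 3 ∷ 1 ∷ 2 ∷ []
p321 = 3 ∷ 2 ∷ 1 ∷ []

_≅_ : ∀ {k} → (Fin k → ℕ) → (Fin k → ℕ) → Set
f ≅ g = ∀ a b → (f a < f b → g a < g b) × (g a < g b → f a < f b)

_≅?_ : ∀ {k} (f g : Fin k → ℕ) → Dec (f ≅ g)
f ≅? g = Fin.all? λ a → Fin.all? λ b →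
  (f a <? f b →-dec g a <? g b) ×-dec (g a <? g b →-dec f a <? f b)

≅-sym : ∀ {k} {f g : Fin k → ℕ} → f ≅ g → g ≅ f
≅-sym f≅g a b = proj₂ (f≅g a b) , proj₁ (f≅g a b)

≅-trans : ∀ {k} {f g h : Fin k → ℕ} → f ≅ g → g ≅ h → f ≅ h
≅-trans f≅g g≅h a b =
  proj₁ (g≅h a b) ∘ proj₁ (f≅g a b) , proj₂ (f≅g a b) ∘ proj₂ (g≅h a b)

≅-resp : ∀ {k} {f f′ g g′ : Fin k → ℕ} → f ≗ f′ → g ≗ g′ → f ≅ g → f′ ≅ g′
≅-resp f≗f′ g≗g′ f≅g a b =
  subst₂ _<_ (g≗g′ a) (g≗g′ b) ∘ proj₁ (f≅g a b) ∘ subst₂ _<_ (sym (f≗f′ a)) (sym (f≗f′ b)) ,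
  subst₂ _<_ (f≗f′ a) (f≗f′ b) ∘ proj₂ (f≅g a b) ∘ subst₂ _<_ (sym (g≗g′ a)) (sym (g≗g′ b))

StrictlyIncreasing : ∀ {k} → (Fin k → ℕ) → Set
StrictlyIncreasing f = ∀ {a b} → a <ᶠ b → f a < f b

lookup-increasing : Increasing t → StrictlyIncreasing (lookup t)
lookup-increasing (x<t ∷ _) {zero} {suc b} _ = All.lookup x<t (∈-lookup b)
lookup-increasing (_ ∷ t↗) {suc a} {suc b} a<b = lookup-increasing t↗ (s<s⁻¹ a<b)

strictlyIncreasing-reflects : ∀ {k} {f : Fin k → ℕ} → StrictlyIncreasing f →
  ∀ {a b} → f a < f b → a <ᶠ b
strictlyIncreasing-reflects f↗ {a} {b} fa<fb with Fin.<-cmp a b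
... | tri< a<b _ _ = a<b
... | tri≈ _ refl _ = ⊥-elim (<-irrefl refl fa<fb)
... | tri> _ _ b<a = ⊥-elim (<-asym fa<fb (f↗ b<a))

≅-rearranged : ∀ {k} {f g : Fin k → ℕ} → StrictlyIncreasing f → StrictlyIncreasing g →
  (ρ : Fin k → Fin k) → (f ∘ ρ) ≅ (g ∘ ρ)
≅-rearranged f↗ g↗ ρ a b =
  g↗ ∘ strictlyIncreasing-reflects f↗ , f↗ ∘ strictlyIncreasing-reflects g↗

⟨_,_,_⟩ : ∀ {A : Set} → A → A → A → Fin 3 → A
⟨ x , y , z ⟩ = lookup (x ∷ y ∷ z ∷ [])

⟨⟩-η : ∀ {A : Set} (f : Fin 3 → A) → ⟨ f zero , f (suc zero) , f (suc (suc zero)) ⟩ ≗ f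
⟨⟩-η f zero = refl
⟨⟩-η f (suc zero) = refl
⟨⟩-η f (suc (suc zero)) = refl

≅-pattern : ∀ {x y z p q r} (i j k : Fin 3) →
  Increasing (x ∷ y ∷ z ∷ []) → Increasing (p ∷ q ∷ r ∷ []) →
  let f = ⟨ x , y , z ⟩ ; g = ⟨ p , q , r ⟩ in ⟨ f i , f j , f k ⟩ ≅ ⟨ g i , g j , g k ⟩
≅-pattern i j k f↗ g↗ =
  ≅-resp (sym ∘ ⟨⟩-η _) (sym ∘ ⟨⟩-η _)
    (≅-rearranged (lookup-increasing f↗) (lookup-increasing g↗) ⟨ i , j , k ⟩)

private
  0F 1F 2F : Fin 3
  0F = zero
  1F = suc zero
  2F = suc (suc zero)

≅-123 : Increasing (x ∷ y ∷ z ∷ []) → ⟨ x , y , z ⟩ ≅ ⟨ 1 , 2 , 3 ⟩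
≅-123 chain = ≅-pattern 0F 1F 2F chain (range-increasing 1 3)

≅-132 : Increasing (x ∷ z ∷ y ∷ []) → ⟨ x , y , z ⟩ ≅ ⟨ 1 , 3 , 2 ⟩
≅-132 chain = ≅-pattern 0F 2F 1F chain (range-increasing 1 3)

≅-213 : Increasing (y ∷ x ∷ z ∷ []) → ⟨ x , y , z ⟩ ≅ ⟨ 2 , 1 , 3 ⟩
≅-213 chain = ≅-pattern 1F 0F 2F chain (range-increasing 1 3)

≅-231 : Increasing (z ∷ x ∷ y ∷ []) → ⟨ x , y , z ⟩ ≅ ⟨ 2 , 3 , 1 ⟩
≅-231 chain = ≅-pattern 1F 2F 0F chain (range-increasing 1 3)

≅-312 : Increasing (y ∷ z ∷ x ∷ []) → ⟨ x , y , z ⟩ ≅ ⟨ 3 , 1 , 2 ⟩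
≅-312 chain = ≅-pattern 2F 0F 1F chain (range-increasing 1 3)

≅-321 : Increasing (z ∷ y ∷ x ∷ []) → ⟨ x , y , z ⟩ ≅ ⟨ 3 , 2 , 1 ⟩
≅-321 chain = ≅-pattern 2F 1F 0F chain (range-increasing 1 3)

⊆⇒embedding : t ⊆ σ → Σ (Fin (length t) → Fin (length σ)) λ c →
  (∀ a b → a <ᶠ b → c a <ᶠ c b) × (∀ a → lookup σ (c a) ≡ lookup t a)
⊆⇒embedding [] = (λ ()) , (λ ()) , (λ ())
⊆⇒embedding (_ ∷ʳ t⊆σ) with ⊆⇒embedding t⊆σ
... | c , c↗ , c-lookup = suc ∘ c , (λ a b → s<s ∘ c↗ a b) , c-lookup
⊆⇒embedding {y ∷ t} {_ ∷ σ} (refl ∷ t⊆σ) with ⊆⇒embedding t⊆σ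
... | c , c↗ , c-lookup = c′ , c′↗ , c′-lookup
  where
  c′ : Fin (suc (length t)) → Fin (suc (length σ))
  c′ zero = zero
  c′ (suc a) = suc (c a)
  c′↗ : ∀ a b → a <ᶠ b → c′ a <ᶠ c′ b
  c′↗ zero (suc b) _ = z<s
  c′↗ (suc a) (suc b) a<b = s<s (c↗ a b (s<s⁻¹ a<b))
  c′-lookup : ∀ a → lookup (y ∷ σ) (c′ a) ≡ lookup (y ∷ t) a
  c′-lookup zero = refl
  c′-lookup (suc a) = c-lookup a

pair-⊆ : ∀ (σ : List ℕ) {i j : Fin (length σ)} → i <ᶠ j →
  lookup σ i ∷ lookup σ j ∷ [] ⊆ σ
pair-⊆ (_ ∷ σ) {zero} {suc j} _ = refl ∷ from∈ (∈-lookup j)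
pair-⊆ (x ∷ σ) {suc i} {suc j} i<j = x ∷ʳ pair-⊆ σ (s<s⁻¹ i<j)

triple-⊆ : ∀ (σ : List ℕ) {i j k : Fin (length σ)} → i <ᶠ j → j <ᶠ k →
  lookup σ i ∷ lookup σ j ∷ lookup σ k ∷ [] ⊆ σ
triple-⊆ (_ ∷ σ) {zero} {suc j} {suc k} _ j<k = refl ∷ pair-⊆ σ (s<s⁻¹ j<k)
triple-⊆ (x ∷ σ) {suc i} {suc j} {suc k} i<j j<k = x ∷ʳ triple-⊆ σ (s<s⁻¹ i<j) (s<s⁻¹ j<k)

contains⇒triple : ∀ {p q r} → Contains σ (p ∷ q ∷ r ∷ []) →
  ∃[ x ] ∃[ y ] ∃[ z ] x ∷ y ∷ z ∷ [] ⊆ σ × ⟨ x , y , z ⟩ ≅ ⟨ p , q , r ⟩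
contains⇒triple {σ} (c , c↗ , c≅π) =
  _ , _ , _ , triple-⊆ σ (c↗ 0F 1F z<s) (c↗ 1F 2F (s<s z<s)) ,
  ≅-resp (sym ∘ ⟨⟩-η (lookup σ ∘ c)) (λ _ → refl) c≅π

triple⇒contains : ∀ {p q r} → x ∷ y ∷ z ∷ [] ⊆ σ → ⟨ x , y , z ⟩ ≅ ⟨ p , q , r ⟩ →
  Contains σ (p ∷ q ∷ r ∷ [])
triple⇒contains t⊆σ t≅π with ⊆⇒embedding t⊆σ
... | c , c↗ , c-lookup = c , c↗ , ≅-resp (sym ∘ c-lookup) (λ _ → refl) t≅π

avoids-∷⁻ : ∀ {π} → Avoids (x ∷ σ) π → Avoids σ π
avoids-∷⁻ x∷σ-avoids (c , c↗ , c≅π) =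
  x∷σ-avoids (suc ∘ c , (λ a b → s<s ∘ c↗ a b) , c≅π)

TriplesOfTypes : List ℕ → List (Fin 3 → ℕ) → Set
TriplesOfTypes σ types = ∀ {x y z} → x ∷ y ∷ z ∷ [] ⊆ σ → Any (⟨ x , y , z ⟩ ≅_) types

-- The implicit argument is discharged by evaluation: no listed type is order-isomorphic to the pattern.
avoids-of-types : ∀ types {p q r} → TriplesOfTypes σ types →
  {False (any? (_≅? ⟨ p , q , r ⟩) types)} → Avoids σ (p ∷ q ∷ r ∷ [])
avoids-of-types types σ-types {π-not-a-type} σ-contains
  with _ , _ , _ , t⊆σ , t≅π ← contains⇒triple σ-contains =
  toWitnessFalse π-not-a-type (Any.map (λ t≅τ → ≅-trans (≅-sym t≅τ) t≅π) (σ-types t⊆σ))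

-- Rotated increasing lists and increasing lists with one inserted entry

⊆-++⁻ : ∀ {A : Set} {t : List A} u {v} → t ⊆ u ++ v →
  ∃[ t₁ ] ∃[ t₂ ] t ≡ t₁ ++ t₂ × t₁ ⊆ u × t₂ ⊆ v
⊆-++⁻ [] t⊆v = [] , _ , refl , [] , t⊆v
⊆-++⁻ (x ∷ u) (_ ∷ʳ t⊆uv) with t₁ , t₂ , refl , t₁⊆u , t₂⊆v ← ⊆-++⁻ u t⊆uv =
  t₁ , t₂ , refl , x ∷ʳ t₁⊆u , t₂⊆v
⊆-++⁻ (x ∷ u) (refl ∷ t⊆uv) with t₁ , t₂ , refl , t₁⊆u , t₂⊆v ← ⊆-++⁻ u t⊆uv =
  x ∷ t₁ , t₂ , refl , refl ∷ t₁⊆u , t₂⊆v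

record RotatedIncreasing (σ : List ℕ) : Set where
  constructor rotation
  field
    front back : List ℕ
    split : σ ≡ front ++ back
    increasing : Increasing (back ++ front)

record InsertedIncreasing (R : ℕ → ℕ → Set) (σ : List ℕ) : Set where
  constructor insertion
  field
    front : List ℕ
    inserted : ℕ
    back : List ℕ
    split : σ ≡ front ++ inserted ∷ back
    increasing : Increasing (front ++ back)
    related : All (R inserted) (front ++ back)

rotated-⊆ : t ⊆ σ → RotatedIncreasing σ → RotatedIncreasing t
rotated-⊆ t⊆σ (rotation u v refl vu↗) with t₁ , t₂ , refl , t₁⊆u , t₂⊆v ← ⊆-++⁻ u t⊆σ =
  rotation t₁ t₂ refl (AllPairs-resp-⊆ (Sublist.++⁺ t₂⊆v t₁⊆u) vu↗)

inserted-⊆ : ∀ {R} → t ⊆ σ → InsertedIncreasing R σ → Increasing t ⊎ InsertedIncreasing R t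
inserted-⊆ t⊆σ (insertion u m w refl uw↗ m-R) with ⊆-++⁻ u t⊆σ
... | t₁ , t₂ , refl , t₁⊆u , _ ∷ʳ t₂⊆w =
  inj₁ (AllPairs-resp-⊆ (Sublist.++⁺ t₁⊆u t₂⊆w) uw↗)
... | t₁ , _ ∷ t₂ , refl , t₁⊆u , refl ∷ t₂⊆w =
  inj₂ (insertion t₁ m t₂ refl (AllPairs-resp-⊆ t₁t₂⊆uw uw↗) (Sublist.All-resp-⊆ t₁t₂⊆uw m-R))
  where
  t₁t₂⊆uw : t₁ ++ t₂ ⊆ u ++ w
  t₁t₂⊆uw = Sublist.++⁺ t₁⊆u t₂⊆w

rotated-types : RotatedIncreasing σ →
  TriplesOfTypes σ (⟨ 1 , 2 , 3 ⟩ ∷ ⟨ 2 , 3 , 1 ⟩ ∷ ⟨ 3 , 1 , 2 ⟩ ∷ [])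
rotated-types σ-rotated t⊆σ = triple-type (rotated-⊆ t⊆σ σ-rotated)
  where
  triple-type : RotatedIncreasing (x ∷ y ∷ z ∷ []) →
    Any (⟨ x , y , z ⟩ ≅_) (⟨ 1 , 2 , 3 ⟩ ∷ ⟨ 2 , 3 , 1 ⟩ ∷ ⟨ 3 , 1 , 2 ⟩ ∷ [])
  triple-type (rotation [] _ refl xyz↗) = here (≅-123 xyz↗)
  triple-type (rotation (_ ∷ []) _ refl yzx↗) = there (there (here (≅-312 yzx↗)))
  triple-type (rotation (_ ∷ _ ∷ []) _ refl zxy↗) = there (here (≅-231 zxy↗))
  triple-type (rotation (_ ∷ _ ∷ _ ∷ []) _ refl xyz↗) = here (≅-123 xyz↗)
  triple-type (rotation (_ ∷ _ ∷ _ ∷ _ ∷ _) _ () _)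

inserted-below-types : InsertedIncreasing _<_ σ →
  TriplesOfTypes σ (⟨ 1 , 2 , 3 ⟩ ∷ ⟨ 2 , 1 , 3 ⟩ ∷ ⟨ 2 , 3 , 1 ⟩ ∷ [])
inserted-below-types σ-inserted t⊆σ with inserted-⊆ t⊆σ σ-inserted
... | inj₁ xyz↗ = here (≅-123 xyz↗)
... | inj₂ (insertion [] _ _ refl ((y<z ∷ []) ∷ _) (x<y ∷ _)) =
  here (≅-123 (increasing₃ x<y y<z))
... | inj₂ (insertion (_ ∷ []) _ _ refl ((x<z ∷ []) ∷ _) (y<x ∷ _)) =
  there (here (≅-213 (increasing₃ y<x x<z)))
... | inj₂ (insertion (_ ∷ _ ∷ []) _ _ refl ((x<y ∷ []) ∷ _) (z<x ∷ _)) =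
  there (there (here (≅-231 (increasing₃ z<x x<y))))
... | inj₂ (insertion (_ ∷ _ ∷ _ ∷ []) _ _ () _ _)
... | inj₂ (insertion (_ ∷ _ ∷ _ ∷ _ ∷ _) _ _ () _ _)

inserted-above-types : InsertedIncreasing _>_ σ →
  TriplesOfTypes σ (⟨ 1 , 2 , 3 ⟩ ∷ ⟨ 1 , 3 , 2 ⟩ ∷ ⟨ 3 , 1 , 2 ⟩ ∷ [])
inserted-above-types σ-inserted t⊆σ with inserted-⊆ t⊆σ σ-inserted
... | inj₁ xyz↗ = here (≅-123 xyz↗)
... | inj₂ (insertion [] _ _ refl ((y<z ∷ []) ∷ _) (_ ∷ z<x ∷ [])) =
  there (there (here (≅-312 (increasing₃ y<z z<x))))
... | inj₂ (insertion (_ ∷ []) _ _ refl ((x<z ∷ []) ∷ _) (_ ∷ z<y ∷ [])) =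
  there (here (≅-132 (increasing₃ x<z z<y)))
... | inj₂ (insertion (_ ∷ _ ∷ []) _ _ refl ((x<y ∷ []) ∷ _) (_ ∷ y<z ∷ [])) =
  here (≅-123 (increasing₃ x<y y<z))
... | inj₂ (insertion (_ ∷ _ ∷ _ ∷ []) _ _ () _ _)
... | inj₂ (insertion (_ ∷ _ ∷ _ ∷ _ ∷ _) _ _ () _ _)

rotated-∷-increasing : All (x ≢_) τ → Increasing τ → Avoids (x ∷ τ) p213 → RotatedIncreasing (x ∷ τ)
rotated-∷-increasing {x} {[]} _ _ _ = rotation (x ∷ []) [] refl ([] ∷ [])
rotated-∷-increasing {x} {b ∷ τ} (x≢b ∷ x∉τ) bτ↗@(b<τ ∷ _) avoids213 with <-cmp x b
... | tri< x<b _ _ =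
  rotation [] (x ∷ b ∷ τ) refl
    (subst Increasing (sym (++-identityʳ _)) ((x<b ∷ All.map (<-trans x<b) b<τ) ∷ bτ↗))
... | tri≈ _ x≡b _ = ⊥-elim (x≢b x≡b)
... | tri> _ _ b<x =
  rotation (x ∷ []) (b ∷ τ) refl
    (increasing-insert (subst Increasing (sym (++-identityʳ _)) bτ↗) (b<x ∷ τ<x) [])
  where
  τ<x : All (_< x) τ
  τ<x = all-below x∉τ λ z∈τ x<z →
    avoids213 (triple⇒contains (refl ∷ refl ∷ from∈ z∈τ) (≅-213 (increasing₃ b<x x<z)))

rotated-of-avoider : Unique σ → Avoids σ p132 → Avoids σ p213 → Avoids σ p321 → RotatedIncreasing σ
rotated-of-avoider {[]} _ _ _ _ = rotation [] [] refl []
rotated-of-avoider {x ∷ τ} (x∉τ ∷ τ!) avoids132 avoids213 avoids321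
  with rotated-of-avoider τ! (avoids-∷⁻ avoids132) (avoids-∷⁻ avoids213) (avoids-∷⁻ avoids321)
... | rotation [] v refl v↗ =
  rotated-∷-increasing x∉τ (subst Increasing (++-identityʳ v) v↗) avoids213
... | rotation u [] refl u↗ =
  rotated-∷-increasing x∉τ (subst Increasing (sym (++-identityʳ u)) u↗) avoids213
... | rotation (a ∷ u) (y ∷ v) refl vau↗ =
  rotation (x ∷ a ∷ u) (y ∷ v) refl (increasing-insert vau↗ yv<x (x<a ∷ All.map (<-trans x<a) a<u))
  where
  yv<au : ∀ {z b} → z ∈ y ∷ v → b ∈ a ∷ u → z < b
  yv<au = increasing-++⁻ vau↗
  a<u : All (a <_) u
  a<u with a<u ∷ _ ← AllPairs-resp-⊆ (Sublist.++⁺ˡ (y ∷ v) ⊆-refl) vau↗ = a<u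
  x<a : x < a
  x<a with <-cmp x a
  ... | tri< x<a _ _ = x<a
  ... | tri≈ _ x≡a _ = ⊥-elim (All.head x∉τ x≡a)
  ... | tri> _ _ a<x =
    ⊥-elim (avoids321 (triple⇒contains (refl ∷ refl ∷ Sublist.++⁺ˡ u (refl ∷ minimum v))
                                       (≅-321 (increasing₃ (yv<au (here refl) (here refl)) a<x))))
  yv<x : All (_< x) (y ∷ v)
  yv<x = all-below (All.++⁻ʳ (a ∷ u) x∉τ) λ z∈yv x<z →
    avoids132 (triple⇒contains (refl ∷ refl ∷ Sublist.++⁺ˡ u (from∈ z∈yv))
                               (≅-132 (increasing₃ x<z (yv<au z∈yv (here refl)))))

inserted-below-∷ : ∀ {x u m w} → All (x ≢_) (u ++ m ∷ w) → Increasing (u ++ w) → All (m <_) (u ++ w) →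
  Avoids (x ∷ u ++ m ∷ w) p132 → Avoids (x ∷ u ++ m ∷ w) p312 → Avoids (x ∷ u ++ m ∷ w) p321 →
  InsertedIncreasing _<_ (x ∷ u ++ m ∷ w)
inserted-below-∷ {x} {u} {m} {w} x∉umw uw↗ m<uw avoids132 avoids312 avoids321 with <-cmp x m
inserted-below-∷ {x} {[]} {m} {w} _ w↗ m<w _ _ _ | tri< x<m _ _ =
  insertion [] x (m ∷ w) refl (m<w ∷ w↗) (x<m ∷ All.map (<-trans x<m) m<w)
inserted-below-∷ {x} {a ∷ u} {m} {w} _ _ m<auw avoids132 _ _ | tri< x<m _ _ =
  ⊥-elim (avoids132 (triple⇒contains (refl ∷ refl ∷ Sublist.++⁺ˡ u (refl ∷ minimum w))
                                     (≅-132 (increasing₃ x<m (All.head m<auw)))))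
... | tri≈ _ x≡m _ = ⊥-elim (All.lookup x∉umw (∈-++⁺ʳ u (here refl)) x≡m)
... | tri> _ _ m<x = insertion (x ∷ u) m w refl (x<uw ∷ uw↗) (m<x ∷ m<uw)
  where
  x≮uw : z ∈ u ++ w → ¬ z < x
  x≮uw z∈uw z<x with m<z ← All.lookup m<uw z∈uw | ∈-++⁻ u z∈uw
  ... | inj₁ z∈u = avoids321 (triple⇒contains (refl ∷ Sublist.++⁺ (from∈ z∈u) (refl ∷ minimum w))
                                              (≅-321 (increasing₃ m<z z<x)))
  ... | inj₂ z∈w = avoids312 (triple⇒contains (refl ∷ Sublist.++⁺ˡ u (refl ∷ from∈ z∈w))
                                              (≅-312 (increasing₃ m<z z<x)))
  x<uw : All (x <_) (u ++ w)
  x<uw = all-above (Sublist.All-resp-⊆ (Sublist.++⁺ ⊆-refl (m ∷ʳ ⊆-refl)) x∉umw) x≮uw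

inserted-below-of-avoider : Unique σ → Avoids σ p132 → Avoids σ p312 → Avoids σ p321 →
  σ ≡ [] ⊎ InsertedIncreasing _<_ σ
inserted-below-of-avoider {[]} _ _ _ _ = inj₁ refl
inserted-below-of-avoider {x ∷ τ} (x∉τ ∷ τ!) avoids132 avoids312 avoids321
  with inserted-below-of-avoider τ! (avoids-∷⁻ avoids132) (avoids-∷⁻ avoids312) (avoids-∷⁻ avoids321)
... | inj₁ refl = inj₂ (insertion [] x [] refl [] [])
... | inj₂ (insertion u m w refl uw↗ m<uw) =
  inj₂ (inserted-below-∷ x∉τ uw↗ m<uw avoids132 avoids312 avoids321)

inserted-above-∷ : ∀ {x u m w} → All (x ≢_) (u ++ m ∷ w) → Increasing (u ++ w) → All (_< m) (u ++ w) →
  Avoids (x ∷ u ++ m ∷ w) p213 → Avoids (x ∷ u ++ m ∷ w) p231 → Avoids (x ∷ u ++ m ∷ w) p321 →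
  InsertedIncreasing _>_ (x ∷ u ++ m ∷ w)
inserted-above-∷ {x} {u} {m} {w} x∉umw uw↗ uw<m avoids213 avoids231 avoids321 with <-cmp x m
... | tri< x<m _ _ = insertion (x ∷ u) m w refl (x<uw ∷ uw↗) (x<m ∷ uw<m)
  where
  x≮uw : z ∈ u ++ w → ¬ z < x
  x≮uw z∈uw z<x with ∈-++⁻ u z∈uw
  ... | inj₁ z∈u = avoids213 (triple⇒contains (refl ∷ Sublist.++⁺ (from∈ z∈u) (refl ∷ minimum w))
                                              (≅-213 (increasing₃ z<x x<m)))
  ... | inj₂ z∈w = avoids231 (triple⇒contains (refl ∷ Sublist.++⁺ˡ u (refl ∷ from∈ z∈w))
                                              (≅-231 (increasing₃ z<x x<m)))
  x<uw : All (x <_) (u ++ w)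
  x<uw = all-above (Sublist.All-resp-⊆ (Sublist.++⁺ ⊆-refl (m ∷ʳ ⊆-refl)) x∉umw) x≮uw
... | tri≈ _ x≡m _ = ⊥-elim (All.lookup x∉umw (∈-++⁺ʳ u (here refl)) x≡m)
inserted-above-∷ {x} {u} {m} {[]} _ u↗ u<m _ _ _ | tri> _ _ m<x =
  insertion [] x (u ++ m ∷ []) refl (increasing-insert u↗ (All.++⁻ˡ u u<m) [])
            (All.++⁺ (All.map (λ z<m → <-trans z<m m<x) (All.++⁻ˡ u u<m)) (m<x ∷ []))
inserted-above-∷ {x} {u} {m} {z ∷ w} _ _ uzw<m _ _ avoids321 | tri> _ _ m<x =
  ⊥-elim (avoids321 (triple⇒contains (refl ∷ Sublist.++⁺ˡ u (refl ∷ refl ∷ minimum w))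
                                     (≅-321 (increasing₃ (All.lookup uzw<m (∈-++⁺ʳ u (here refl))) m<x))))

inserted-above-of-avoider : Unique σ → Avoids σ p213 → Avoids σ p231 → Avoids σ p321 →
  σ ≡ [] ⊎ InsertedIncreasing _>_ σ
inserted-above-of-avoider {[]} _ _ _ _ = inj₁ refl
inserted-above-of-avoider {x ∷ τ} (x∉τ ∷ τ!) avoids213 avoids231 avoids321
  with inserted-above-of-avoider τ! (avoids-∷⁻ avoids213) (avoids-∷⁻ avoids231) (avoids-∷⁻ avoids321)
... | inj₁ refl = inj₂ (insertion [] x [] refl [] [])
... | inj₂ (insertion u m w refl uw↗ uw<m) =
  inj₂ (inserted-above-∷ x∉τ uw↗ uw<m avoids213 avoids231 avoids321)

-- Ballot lists with at most one descent

<ᵇ-true : x < y → (x <ᵇ y) ≡ true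
<ᵇ-true x<y = Equivalence.to T-≡ (<⇒<ᵇ x<y)

<ᵇ-false : ¬ x < y → (x <ᵇ y) ≡ false
<ᵇ-false {x} {y} x≮y = ¬-not (x≮y ∘ <ᵇ⇒< x y ∘ Equivalence.from T-≡)

desFrom-prefix : ∀ {p} → Prefix p σ → desFrom x p ≤ desFrom x σ
desFrom-prefix pre-[] = z≤n
desFrom-prefix {x = x} (pre-∷ {y} p⊑σ) = +-monoʳ-≤ (if y <ᵇ x then 1 else 0) (desFrom-prefix p⊑σ)

des-prefix : ∀ {p} → Prefix p σ → des p ≤ des σ
des-prefix pre-[] = z≤n
des-prefix (pre-∷ p⊑σ) = desFrom-prefix p⊑σ

desFrom-increasing : All (x <_) σ → Increasing σ → desFrom x σ ≡ 0
desFrom-increasing [] [] = refl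
desFrom-increasing (x<y ∷ _) (y<σ ∷ σ↗) rewrite <ᵇ-false (<-asym x<y) = desFrom-increasing y<σ σ↗

des-increasing : Increasing σ → des σ ≡ 0
des-increasing [] = refl
des-increasing (x<σ ∷ σ↗) = desFrom-increasing x<σ σ↗

des-two-runs : Increasing u → Increasing v → des (u ++ v) ≤ 1
des-two-runs {[]} _ v↗ = subst (_≤ 1) (sym (des-increasing v↗)) z≤n
des-two-runs {_ ∷ []} {[]} _ _ = z≤n
des-two-runs {a ∷ []} {y ∷ _} _ (y<v ∷ v↗) rewrite desFrom-increasing y<v v↗ with y <ᵇ a
... | true = ≤-refl
... | false = z≤n
des-two-runs {_ ∷ _ ∷ _} ((a<b ∷ _) ∷ bu↗) v↗ rewrite <ᵇ-false (<-asym a<b) = des-two-runs bu↗ v↗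

increasing⇒ballot : Increasing σ → IsBallot σ
increasing⇒ballot σ↗ p p⊑σ =
  ≤-trans (des-prefix p⊑σ) (subst (_≤ asc p) (sym (des-increasing σ↗)) z≤n)

-- A prefix longer than one already contains the ascent between the first two entries, and no prefix
-- contains more than the one descent of u ++ v.
two-runs⇒ballot : Increasing u → Increasing v → 2 ≤ length u → IsBallot (u ++ v)
two-runs⇒ballot {_ ∷ _ ∷ _} _ _ _ _ pre-[] = z≤n
two-runs⇒ballot {_ ∷ _ ∷ _} _ _ _ _ (pre-∷ pre-[]) = z≤n
two-runs⇒ballot {_ ∷ _ ∷ _} u↗@((a<b ∷ _) ∷ _) v↗ _ _ p⊑σ@(pre-∷ (pre-∷ _)) rewrite <ᵇ-true a<b =
  ≤-trans (des-prefix p⊑σ) (≤-trans (des-two-runs u↗ v↗) (s≤s z≤n))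
two-runs⇒ballot {[]} _ _ ()
two-runs⇒ballot {_ ∷ []} _ _ (s≤s ())

ballot⇒no-initial-descent : IsBallot (x ∷ y ∷ σ) → ¬ y < x
ballot⇒no-initial-descent ballot y<x with ballot _ (pre-∷ (pre-∷ pre-[]))
... | des≤asc rewrite <ᵇ-true y<x | <ᵇ-false (<-asym y<x) = 1+n≰n des≤asc

-- Counting the three families

Unique-map⁺ : ∀ {A B : Set} {f : A → B} {J} →
  (∀ {i j} → i ∈ J → j ∈ J → f i ≡ f j → i ≡ j) → Unique J → Unique (map f J)
Unique-map⁺ {J = []} _ [] = []
Unique-map⁺ {J = i ∷ J} f-injective (i∉J ∷ J!) =
  All.map⁺ (All.tabulate λ j∈J → All.lookup i∉J j∈J ∘ f-injective (here refl) (there j∈J)) ∷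
  Unique-map⁺ (λ i∈J j∈J → f-injective (there i∈J) (there j∈J)) J!

hasCard-image : ∀ {S : List ℕ → Set} (f : ℕ → List ℕ) {J} → Unique J →
  (∀ {i j} → i ∈ J → j ∈ J → f i ≡ f j → i ≡ j) →
  (∀ {j} → j ∈ J → S (f j)) → (∀ {σ} → S σ → ∃[ j ] j ∈ J × σ ≡ f j) → HasCard S (length J)
hasCard-image {S} f {J} J! f-injective image⊆S S⊆image =
  map f J , Unique-map⁺ f-injective J! , (λ σ → mk⇔ to from) , length-map f J
  where
  to : σ ∈ map f J → S σ
  to σ∈ with j , j∈J , refl ← ∈-map⁻ f σ∈ = image⊆S j∈J
  from : S σ → σ ∈ map f J
  from Sσ with j , j∈J , refl ← S⊆image Sσ = ∈-map⁺ f j∈J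

↭-range : IsPerm n σ → σ ↭ range 1 n
↭-range {n} = subst (_ ↭_) (upTo-range n)

perm-unique : IsPerm n σ → Unique σ
perm-unique {n} σ↭ = Unique-resp-↭ (setoid ℕ) (↭⇒↭ₛ (↭-sym (↭-range σ↭))) (range-unique 1 n)

rotated : ℕ → ℕ → List ℕ
rotated n k = range (suc k) (n ∸ k) ++ range 1 k

rotated-head : k < n → ∃[ rest ] rotated n k ≡ suc k ∷ rest
rotated-head {k} {suc n} (s≤s k≤n) rewrite +-∸-assoc 1 k≤n = _ , refl

rotated-injective : ∀ {i j} → i < n → j < n → rotated n i ≡ rotated n j → i ≡ j
rotated-injective i<n j<n eq with rotated-head i<n | rotated-head j<n
... | _ , i-head | _ , j-head = suc-injective (∷-injectiveˡ (trans (sym i-head) (trans eq j-head)))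

inserted : ℕ → ℕ → ℕ → ℕ → List ℕ
inserted m a n j = range a j ++ m ∷ range (a + j) (n ∸ j)

inserted-injective : ∀ {i j} → m ∉ range a i → m ∉ range a j →
  inserted m a n i ≡ inserted m a n j → i ≡ j
inserted-injective {a = a} {i = i} {j} m∉i m∉j eq =
  trans (sym (length-range a i)) (trans (cong length (++-∷-cancel m∉i m∉j eq)) (length-range a j))

module _ (n : ℕ) where

  -- The identity, and the rotations whose first block has at least two entries.
  rotation-indices : List ℕ
  rotation-indices = 0 ∷ range 1 (n ∸ 1)

  rotation-index-< : k ∈ rotation-indices → k < suc n
  rotation-index-< (here refl) = z<s
  rotation-index-< (there k∈r) = <-trans (n<1+n _) (proj₂ (∈-range∸1⁻ k∈r))

  rotated-member : k ∈ rotation-indices → InB3 (suc n) p132 p213 p321 (rotated (suc n) k)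
  rotated-member {k} k∈J =
    perm , ballot k∈J , avoids-of-types _ types , avoids-of-types _ types , avoids-of-types _ types
    where
    sorted : range 1 k ++ range (suc k) (suc n ∸ k) ≡ range 1 (suc n)
    sorted = range-split (<⇒≤ (rotation-index-< k∈J))
    perm : IsPerm (suc n) (rotated (suc n) k)
    perm = ↭-trans (++-comm _ (range 1 k)) (↭-reflexive (trans sorted (sym (upTo-range (suc n)))))
    types : TriplesOfTypes (rotated (suc n) k) (⟨ 1 , 2 , 3 ⟩ ∷ ⟨ 2 , 3 , 1 ⟩ ∷ ⟨ 3 , 1 , 2 ⟩ ∷ [])
    types = rotated-types (rotation (range (suc k) (suc n ∸ k)) (range 1 k) refl
      (subst Increasing (sym sorted) (range-increasing 1 (suc n))))
    ballot : k ∈ rotation-indices → IsBallot (rotated (suc n) k)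
    ballot (here refl) = increasing⇒ballot (subst Increasing (sym (++-identityʳ _)) (range-increasing 1 (suc n)))
    ballot (there k∈r) = two-runs⇒ballot (range-increasing _ _) (range-increasing 1 k)
      (subst (2 ≤_) (sym (length-range _ _)) (m+n≤o⇒m≤o∸n 2 (proj₂ (∈-range∸1⁻ k∈r))))

  rotated-complete : InB3 (suc n) p132 p213 p321 σ → ∃[ k ] k ∈ rotation-indices × σ ≡ rotated (suc n) k
  rotated-complete (perm , ballot , avoids132 , avoids213 , avoids321)
    with rotation u v refl vu↗ ← rotated-of-avoider (perm-unique perm) avoids132 avoids213 avoids321 =
    index u v (increasing-↭ vu↗ (range-increasing 1 (suc n)) (↭-trans (++-comm v u) (↭-range perm)))
          vu↗ ballot
    where
    index : ∀ u v → v ++ u ≡ range 1 (suc n) → Increasing (v ++ u) → IsBallot (u ++ v) →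
      ∃[ k ] k ∈ rotation-indices × u ++ v ≡ rotated (suc n) k
    index u [] u≡r _ _ = 0 , here refl , cong (_++ []) u≡r
    index [] v v≡r _ _ = 0 , here refl , trans (sym (++-identityʳ v)) (trans v≡r (sym (++-identityʳ _)))
    index (_ ∷ []) (_ ∷ _) _ vu↗ ballot =
      ⊥-elim (ballot⇒no-initial-descent ballot (increasing-++⁻ vu↗ (here refl) (here refl)))
    index u@(_ ∷ _ ∷ _) v@(_ ∷ _) vu≡r _ _ =
      length v ,
      there (∈-range∸1⁺ (s≤s z≤n)
                       (m+o≡n∧p≤o⇒p+m≤n (length-++-range v vu≡r) (s≤s (s≤s z≤n)))) ,
      cong₂ _++_ (proj₂ (++-range⁻ v vu≡r)) (proj₁ (++-range⁻ v vu≡r))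

  rotated-count : HasCard (InB3 (suc n) p132 p213 p321) (suc (n ∸ 1))
  rotated-count = subst (HasCard _) (cong suc (length-range 1 (n ∸ 1)))
    (hasCard-image (rotated (suc n)) indices-unique
      (λ i∈J j∈J → rotated-injective (rotation-index-< i∈J) (rotation-index-< j∈J))
      rotated-member rotated-complete)
    where
    indices-unique : Unique rotation-indices
    indices-unique = All.tabulate (λ k∈r → <⇒≢ (proj₁ (∈-range⁻ k∈r))) ∷ range-unique 1 (n ∸ 1)

module _ (n : ℕ) where

  -- The identity, and the insertions of 1 after at least two entries.
  min-insertion-indices : List ℕ
  min-insertion-indices = 0 ∷ range 2 (n ∸ 1)

  min-insertion-index-≤ : k ∈ min-insertion-indices → k ≤ n
  min-insertion-index-≤ (here refl) = z≤n
  min-insertion-index-≤ (there k∈r) = s≤s⁻¹ (s≤s⁻¹ (proj₂ (∈-range∸1⁻ k∈r)))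

  1∉range-from-2 : 1 ∉ range 2 k
  1∉range-from-2 1∈r = 1+n≰n (proj₁ (∈-range⁻ 1∈r))

  min-inserted-member : k ∈ min-insertion-indices → InB3 (suc n) p132 p312 p321 (inserted 1 2 n k)
  min-inserted-member {k} k∈J =
    perm , ballot k∈J , avoids-of-types _ types , avoids-of-types _ types , avoids-of-types _ types
    where
    sorted : range 2 k ++ range (2 + k) (n ∸ k) ≡ range 2 n
    sorted = range-split (min-insertion-index-≤ k∈J)
    perm : IsPerm (suc n) (inserted 1 2 n k)
    perm = ↭-trans (shift 1 (range 2 k) _) (↭-reflexive (trans (cong (1 ∷_) sorted) (sym (upTo-range (suc n)))))
    types : TriplesOfTypes (inserted 1 2 n k) (⟨ 1 , 2 , 3 ⟩ ∷ ⟨ 2 , 1 , 3 ⟩ ∷ ⟨ 2 , 3 , 1 ⟩ ∷ [])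
    types = inserted-below-types (insertion (range 2 k) 1 (range (2 + k) (n ∸ k)) refl
      (subst Increasing (sym sorted) (range-increasing 2 n))
      (subst (All (1 <_)) (sym sorted) (All.tabulate (proj₁ ∘ ∈-range⁻))))
    ballot : k ∈ min-insertion-indices → IsBallot (inserted 1 2 n k)
    ballot (here refl) = increasing⇒ballot (range-increasing 1 (suc n))
    ballot (there k∈r) = two-runs⇒ballot (range-increasing 2 k)
      (All.tabulate (λ x∈r → ≤-trans (m≤m+n 2 k) (proj₁ (∈-range⁻ x∈r))) ∷
       range-increasing (2 + k) (n ∸ k))
      (subst (2 ≤_) (sym (length-range 2 k)) (proj₁ (∈-range∸1⁻ {n = n} k∈r)))

  min-inserted-sorted : Increasing (u ++ w) → All (m <_) (u ++ w) → IsPerm (suc n) (u ++ m ∷ w) →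
    m ≡ 1 × u ++ w ≡ range 2 n
  min-inserted-sorted {u} {w} {m} uw↗ m<uw perm = ∷-injective
    (increasing-↭ (m<uw ∷ uw↗) (range-increasing 1 (suc n)) (↭-trans (↭-sym (shift m u w)) (↭-range perm)))

  min-inserted-complete : InB3 (suc n) p132 p312 p321 σ →
    ∃[ k ] k ∈ min-insertion-indices × σ ≡ inserted 1 2 n k
  min-inserted-complete (perm , ballot , avoids132 , avoids312 , avoids321)
    with inserted-below-of-avoider (perm-unique perm) avoids132 avoids312 avoids321
  ... | inj₁ refl = ⊥-elim (0≢1+n (↭-length perm))
  ... | inj₂ (insertion u m w refl uw↗ m<uw) with refl , uw≡r ← min-inserted-sorted uw↗ m<uw perm =
    index u w uw≡r m<uw ballot
    where
    index : ∀ u w → u ++ w ≡ range 2 n → All (1 <_) (u ++ w) → IsBallot (u ++ 1 ∷ w) →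
      ∃[ k ] k ∈ min-insertion-indices × u ++ 1 ∷ w ≡ inserted 1 2 n k
    index [] w w≡r _ _ = 0 , here refl , cong (1 ∷_) w≡r
    index (_ ∷ []) w _ 1<aw ballot = ⊥-elim (ballot⇒no-initial-descent ballot (All.head 1<aw))
    index u@(_ ∷ _ ∷ _) w uw≡r _ _ =
      length u ,
      there (∈-range∸1⁺ (s≤s (s≤s z≤n))
                       (s≤s (s≤s (m+o≡n∧p≤o⇒p+m≤n {p = 0} (length-++-range u uw≡r) z≤n)))) ,
      cong₂ (λ u w → u ++ 1 ∷ w) (proj₁ (++-range⁻ u uw≡r)) (proj₂ (++-range⁻ u uw≡r))

  min-inserted-count : HasCard (InB3 (suc n) p132 p312 p321) (suc (n ∸ 1))
  min-inserted-count = subst (HasCard _) (cong suc (length-range 2 (n ∸ 1)))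
    (hasCard-image (inserted 1 2 n) indices-unique (λ _ _ → inserted-injective 1∉range-from-2 1∉range-from-2)
      min-inserted-member min-inserted-complete)
    where
    indices-unique : Unique min-insertion-indices
    indices-unique =
      All.tabulate (λ k∈r → <⇒≢ (≤-trans (s≤s z≤n) (proj₁ (∈-range⁻ k∈r)))) ∷
      range-unique 2 (n ∸ 1)

module _ (n : ℕ) where

  -- The identity, and the insertions of n + 1 with at least one entry on either side.
  max-insertion-indices : List ℕ
  max-insertion-indices = n ∷ range 1 (n ∸ 1)

  max-insertion-index-≤ : k ∈ max-insertion-indices → k ≤ n
  max-insertion-index-≤ (here refl) = ≤-refl
  max-insertion-index-≤ (there k∈r) = <⇒≤ (s≤s⁻¹ (proj₂ (∈-range∸1⁻ k∈r)))

  1+n∉range : k ≤ n → suc n ∉ range 1 k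
  1+n∉range k≤n 1+n∈r = <⇒≱ (proj₂ (∈-range⁻ 1+n∈r)) (s≤s k≤n)

  max-inserted-member : k ∈ max-insertion-indices → InB3 (suc n) p213 p231 p321 (inserted (suc n) 1 n k)
  max-inserted-member {k} k∈J =
    perm , ballot k∈J , avoids-of-types _ types , avoids-of-types _ types , avoids-of-types _ types
    where
    k≤n : k ≤ n
    k≤n = max-insertion-index-≤ k∈J
    sorted : range 1 k ++ range (1 + k) (n ∸ k) ≡ range 1 n
    sorted = range-split k≤n
    perm : IsPerm (suc n) (inserted (suc n) 1 n k)
    perm = ↭-trans (shift (suc n) (range 1 k) _) (↭-trans (∷↭∷ʳ (suc n) _) (↭-reflexive (begin
      (range 1 k ++ range (1 + k) (n ∸ k)) ++ suc n ∷ []  ≡⟨ cong (_++ suc n ∷ []) sorted ⟩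
      range 1 n ++ suc n ∷ []                            ≡⟨ range-∷ʳ 1 n ⟨
      range 1 (suc n)                                    ≡⟨ upTo-range (suc n) ⟨
      map suc (upTo (suc n))                             ∎)))
      where open ≡-Reasoning
    types : TriplesOfTypes (inserted (suc n) 1 n k)
                           (⟨ 1 , 2 , 3 ⟩ ∷ ⟨ 1 , 3 , 2 ⟩ ∷ ⟨ 3 , 1 , 2 ⟩ ∷ [])
    types = inserted-above-types (insertion (range 1 k) (suc n) (range (1 + k) (n ∸ k)) refl
      (subst Increasing (sym sorted) (range-increasing 1 n))
      (subst (All (_< suc n)) (sym sorted) (All.tabulate (proj₂ ∘ ∈-range⁻))))
    ballot : k ∈ max-insertion-indices → IsBallot (inserted (suc n) 1 n k)
    ballot (here refl) rewrite n∸n≡0 n =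
      increasing⇒ballot (subst Increasing (range-∷ʳ 1 n) (range-increasing 1 (suc n)))
    ballot (there k∈r) = subst IsBallot (++-assoc (range 1 k) (suc n ∷ []) _) (two-runs⇒ballot
      (increasing-insert (subst Increasing (sym (++-identityʳ _)) (range-increasing 1 k))
                         (All.tabulate (λ x∈r → <-≤-trans (proj₂ (∈-range⁻ x∈r)) (s≤s k≤n))) [])
      (range-increasing (1 + k) (n ∸ k))
      (subst (2 ≤_) (sym (trans (length-++ (range 1 k)) (cong (_+ 1) (length-range 1 k))))
             (+-monoˡ-≤ 1 (proj₁ (∈-range∸1⁻ {n = n} k∈r)))))

  max-inserted-sorted : Increasing (u ++ w) → All (_< m) (u ++ w) → IsPerm (suc n) (u ++ m ∷ w) →
    u ++ w ≡ range 1 n × m ≡ suc n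
  max-inserted-sorted {u} {w} {m} uw↗ uw<m perm =
    ∷ʳ-injective (u ++ w) (range 1 n) (trans sorted (range-∷ʳ 1 n))
    where
    sorted : (u ++ w) ++ m ∷ [] ≡ range 1 (suc n)
    sorted = increasing-↭ (increasing-insert (subst Increasing (sym (++-identityʳ _)) uw↗) uw<m [])
      (range-increasing 1 (suc n))
      (↭-trans (↭-sym (∷↭∷ʳ m (u ++ w))) (↭-trans (↭-sym (shift m u w)) (↭-range perm)))

  max-inserted-complete : InB3 (suc n) p213 p231 p321 σ →
    ∃[ k ] k ∈ max-insertion-indices × σ ≡ inserted (suc n) 1 n k
  max-inserted-complete (perm , ballot , avoids213 , avoids231 , avoids321)
    with inserted-above-of-avoider (perm-unique perm) avoids213 avoids231 avoids321
  ... | inj₁ refl = ⊥-elim (0≢1+n (↭-length perm))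
  ... | inj₂ (insertion u m w refl uw↗ uw<m) with uw≡r , refl ← max-inserted-sorted uw↗ uw<m perm =
    index u w uw≡r uw<m ballot
    where
    index : ∀ u w → u ++ w ≡ range 1 n → All (_< suc n) (u ++ w) → IsBallot (u ++ suc n ∷ w) →
      ∃[ k ] k ∈ max-insertion-indices × u ++ suc n ∷ w ≡ inserted (suc n) 1 n k
    index u [] u≡r _ _ =
      n , here refl ,
      cong₂ (λ u w → u ++ suc n ∷ w) (trans (sym (++-identityʳ u)) u≡r)
                                     (cong (range (suc n)) (sym (n∸n≡0 n)))
    index [] (_ ∷ _) _ w<m ballot = ⊥-elim (ballot⇒no-initial-descent ballot (All.head w<m))
    index u@(_ ∷ _) w@(_ ∷ _) uw≡r _ _ =
      length u ,
      there (∈-range∸1⁺ (s≤s z≤n)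
                       (s≤s (m+o≡n∧p≤o⇒p+m≤n {p = 1} (length-++-range u uw≡r) (s≤s z≤n)))) ,
      cong₂ (λ u w → u ++ suc n ∷ w) (proj₁ (++-range⁻ u uw≡r)) (proj₂ (++-range⁻ u uw≡r))

  max-inserted-count : HasCard (InB3 (suc n) p213 p231 p321) (suc (n ∸ 1))
  max-inserted-count = subst (HasCard _) (cong suc (length-range 1 (n ∸ 1)))
    (hasCard-image (inserted (suc n) 1 n) indices-unique
      (λ i∈J j∈J → inserted-injective (1+n∉range (max-insertion-index-≤ i∈J))
                                      (1+n∉range (max-insertion-index-≤ j∈J)))
      max-inserted-member max-inserted-complete)
    where
    indices-unique : Unique max-insertion-indices
    indices-unique =
      All.tabulate (λ k∈r → <⇒≢ (s≤s⁻¹ (proj₂ (∈-range∸1⁻ k∈r))) ∘ sym) ∷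
      range-unique 1 (n ∸ 1)

theorem4p5 : ∀ (n : ℕ) → 1 ≤ n →
    Σ ℕ λ k →
      HasCard (InB3 n (1 ∷ 3 ∷ 2 ∷ []) (2 ∷ 1 ∷ 3 ∷ []) (3 ∷ 2 ∷ 1 ∷ [])) k ×
      HasCard (InB3 n (1 ∷ 3 ∷ 2 ∷ []) (3 ∷ 1 ∷ 2 ∷ []) (3 ∷ 2 ∷ 1 ∷ [])) k ×
      HasCard (InB3 n (2 ∷ 1 ∷ 3 ∷ []) (2 ∷ 3 ∷ 1 ∷ []) (3 ∷ 2 ∷ 1 ∷ [])) k
theorem4p5 (suc n) _ = suc (n ∸ 1) , rotated-count n , min-inserted-count n , max-inserted-count n
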